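{- For every $n\ge1$, the map $\gamma$ is a bijection from $\mathcal{C}_n$ onto $\mathcal{A}_n$, and for every $c\in\mathcal{C}_n$, $$(\mathrm{ASC},\mathrm{DIST},\mathrm{ZERO},\mathrm{RMIN})(c)=(\mathrm{ASC},\mathrm{DIST},\mathrm{ZERO},\mathrm{RMIN})(\gamma(c)).$$
   Context: An inversion sequence of length $n$ is $s=(s_1,\dots,s_n)$ with $0\le s_i<i$. $\mathsf{asc}(s)=|\{i\in[n-1]:s_i<s_{i+1}\}|$; an ascent sequence is an inversion sequence with $s_i\le\mathsf{asc}(s_1,\dots,s_{i-1})+1$ for $2\le i\le n$; $\mathcal{A}_n$ is the set of ascent sequences of length $n$. $\mathcal{C}_n$ is the set of inversion sequences $c$ of length $n$ such that whenever $c_i\ge c_{i+1}$, the integer $i$ does not occur among $c_{i+1},\dots,c_n$. $\mathrm{NASC}(c)=\{i\in[n-1]:c_i\ge c_{i+1}\}$. The map $\gamma$: given $c\in\mathcal{C}_n$ with $\mathrm{NASC}(c)=\{i_1>\dots>i_k\}$, for $i=i_1,\dots,i_k$ in this order and for $j=i+1,\dots,n$ in order, if (currently) $c_j>i$ replace $c_j$ by $c_j-1$; $\gamma(c)$ is the result. For an inversion sequence $s$: $\mathrm{ASC}(s)=\{i\in[n-1]:s_i<s_{i+1}\}$; $\mathrm{DIST}(s)=\{2\le i\le n:s_i\ne0,\ s_i\ne s_j\ \forall j>i\}$; $\mathrm{ZERO}(s)=\{i:s_i=0\}$; $\mathrm{RMIN}(s)=\{i:s_i<s_j\ \forall j>i\}$.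 -}

module Defs where

open import Data.Nat using (ℕ; zero; suc; _+_; _∸_; _≤_; _<_; _≥_; _<ᵇ_)
open import Data.Bool using (Bool; true; false; if_then_else_; _∧_; not)
open import Data.List using (List; []; _∷_; length; take; downFrom; filterᵇ; foldl)
open import Data.Product using (_×_; Σ-syntax)
open import Relation.Binary.PropositionalEquality using (_≡_; _≢_)

-- Sequences are lists of naturals; positions are 1-based as in the paper.

-- s ⟨ i ⟩ is the i-th entry s_i (1-based); default 0 outside 1..length s
-- (only ever used under explicit range guards).
_⟨_⟩ : List ℕ → ℕ → ℕ
[]       ⟨ _ ⟩           = 0
(x ∷ xs) ⟨ zero ⟩        = 0
(x ∷ xs) ⟨ suc zero ⟩    = x
(x ∷ xs) ⟨ suc (suc k) ⟩ = xs ⟨ suc k ⟩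

asc : List ℕ → ℕ
asc []             = 0
asc (x ∷ [])       = 0
asc (x ∷ y ∷ rest) = (if x <ᵇ y then 1 else 0) + asc (y ∷ rest)

IsInversionSeq : List ℕ → Set
IsInversionSeq s = ∀ i → 1 ≤ i → i ≤ length s → s ⟨ i ⟩ < i

IsAscentSeq : List ℕ → Set
IsAscentSeq s = IsInversionSeq s ×
  (∀ i → 2 ≤ i → i ≤ length s → s ⟨ i ⟩ ≤ asc (take (i ∸ 1) s) + 1)

InA : ℕ → List ℕ → Set
InA n s = length s ≡ n × IsAscentSeq s

InC : ℕ → List ℕ → Set
InC n c = length c ≡ n × IsInversionSeq c ×
  (∀ i → 1 ≤ i → i < length c → c ⟨ i ⟩ ≥ c ⟨ suc i ⟩ →
     ∀ j → i < j → j ≤ length c → c ⟨ j ⟩ ≢ i)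

nascᵇ : List ℕ → ℕ → Bool
nascᵇ c i = (0 <ᵇ i) ∧ (i <ᵇ length c) ∧ not (c ⟨ i ⟩ <ᵇ c ⟨ suc i ⟩)

nascDesc : List ℕ → List ℕ
nascDesc c = filterᵇ (nascᵇ c) (downFrom (length c))

-- one step of γ for index i: for every position j > i, if c_j > i replace c_j by c_j - 1.
-- decAfterFrom i p s : p is the 1-based position of the head of s.
decAfterFrom : ℕ → ℕ → List ℕ → List ℕ
decAfterFrom i p []       = []
decAfterFrom i p (x ∷ xs) =
  (if (i <ᵇ p) ∧ (i <ᵇ x) then x ∸ 1 else x) ∷ decAfterFrom i (suc p) xs

decAfter : ℕ → List ℕ → List ℕ
decAfter i s = decAfterFrom i 1 s

-- the map γ: process i = i₁, …, i_k (NASC of the original c) in this order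
γ : List ℕ → List ℕ
γ c = foldl (λ s i → decAfter i s) c (nascDesc c)

ASC : List ℕ → ℕ → Set
ASC s i = 1 ≤ i × i < length s × s ⟨ i ⟩ < s ⟨ suc i ⟩

DIST : List ℕ → ℕ → Set
DIST s i = 2 ≤ i × i ≤ length s × s ⟨ i ⟩ ≢ 0 ×
  (∀ j → i < j → j ≤ length s → s ⟨ i ⟩ ≢ s ⟨ j ⟩)

ZERO : List ℕ → ℕ → Set
ZERO s i = 1 ≤ i × i ≤ length s × s ⟨ i ⟩ ≡ 0

RMIN : List ℕ → ℕ → Set
RMIN s i = 1 ≤ i × i ≤ length s ×
  (∀ j → i < j → j ≤ length s → s ⟨ i ⟩ < s ⟨ j ⟩)

-- γ only changes values. When the marks i ∈ NASC(c) are processed in decreasing order, an entry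
-- v > i has so far lost only the marks lying in (i, v), so it still exceeds i, and its position
-- exceeds v because c is an inversion sequence. Hence γ replaces every entry v by
-- rank v = v − #{k < v : k ∈ NASC(c)}. For c ∈ 𝒞_n no entry lies in NASC(c), and rank is strictly
-- increasing on such values, so γ preserves all comparisons between entries, and with them NASC,
-- ASC, DIST, ZERO and RMIN. Every 0 < k < v is an ascent or a non-ascent, which bounds rank(c_i)
-- by one more than the number of ascents before i. Since NASC(c) = NASC(γ c), γ is injective, and
-- sending k to the k-th value outside NASC(a) inverts γ on 𝒜_n.

module Submission where

open import Defs
open import Data.Bool using (Bool; true; false; T; if_then_else_; _∧_; _∨_)
open import Data.Bool.Properties using (T-≡; ∧-zeroʳ)
open import Data.List using (List; []; _∷_; length; take; downFrom; filterᵇ; foldl; map)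
open import Data.List.Properties
  using (length-map; take-map; map-cong; map-id; map-∘; ∷-injective; filter-accept; filter-reject)
open import Data.List.Relation.Unary.All using (All; []; _∷_)
open import Data.List.Relation.Unary.All.Properties using (take⁺)
open import Data.Nat
open import Data.Nat.Properties
open import Algebra.Properties.CommutativeSemigroup +-commutativeSemigroup
  using (interchange; x∙yz≈y∙xz)
open import Data.Product using (_×_; _,_; proj₂; Σ-syntax)
open import Data.Sum using (inj₁; inj₂)
open import Data.Unit using (⊤; tt)
open import Function.Base using (_∘_)
open import Function.Bundles using (_⇔_; mk⇔; Equivalence)
open import Relation.Nullary using (yes; no; contradiction)
open import Relation.Nullary.Decidable using (T?)
open import Relation.Binary.PropositionalEquality
open import Relation.Binary.Definitions using (tri<; tri≈; tri>)

<⇒<ᵇ≡true : ∀ {m n} → m < n → (m <ᵇ n) ≡ true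
<⇒<ᵇ≡true = Equivalence.to T-≡ ∘ <⇒<ᵇ

<ᵇ≡true⇒< : ∀ {m n} → (m <ᵇ n) ≡ true → m < n
<ᵇ≡true⇒< {m} {n} e = <ᵇ⇒< m n (Equivalence.from T-≡ e)

<ᵇ≡false⇒≥ : ∀ {m n} → (m <ᵇ n) ≡ false → n ≤ m
<ᵇ≡false⇒≥ e = ≮⇒≥ (λ m<n → subst T e (<⇒<ᵇ m<n))

≥⇒<ᵇ≡false : ∀ {m n} → n ≤ m → (m <ᵇ n) ≡ false
≥⇒<ᵇ≡false {m} {n} n≤m with m <ᵇ n in e
... | false = refl
... | true  = contradiction (<ᵇ≡true⇒< e) (≤⇒≯ n≤m)

n<m⇒m∸n≡1+m∸[1+n] : ∀ {a b} → b < a → a ∸ b ≡ suc (a ∸ suc b)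
n<m⇒m∸n≡1+m∸[1+n] {suc a} (s≤s b≤a) = +-∸-assoc 1 b≤a

fromBool : Bool → ℕ
fromBool b = if b then 1 else 0

fromBool≤1 : ∀ b → fromBool b ≤ 1
fromBool≤1 true  = ≤-refl
fromBool≤1 false = z≤n

fromBool-∨-∧ : ∀ a b → fromBool a + fromBool b ≡ fromBool (a ∨ b) + fromBool (a ∧ b)
fromBool-∨-∧ true  true  = refl
fromBool-∨-∧ true  false = refl
fromBool-∨-∧ false true  = refl
fromBool-∨-∧ false false = refl

count : (ℕ → Bool) → ℕ → ℕ
count P zero    = 0
count P (suc v) = fromBool (P v) + count P v

count-cong : ∀ {P Q} → (∀ k → P k ≡ Q k) → ∀ v → count P v ≡ count Q v
count-cong P≗Q zero    = refl
count-cong P≗Q (suc v) = cong₂ _+_ (cong fromBool (P≗Q v)) (count-cong P≗Q v)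

count-false : ∀ P → (∀ k → P k ≡ false) → ∀ v → count P v ≡ 0
count-false P P≗false zero    = refl
count-false P P≗false (suc v) rewrite P≗false v = count-false P P≗false v

count≤ : ∀ P v → count P v ≤ v
count≤ P zero    = z≤n
count≤ P (suc v) = +-mono-≤ (fromBool≤1 (P v)) (count≤ P v)

count-+ : ∀ P v d → count P (d + v) ≤ d + count P v
count-+ P v zero    = ≤-refl
count-+ P v (suc d) = +-mono-≤ (fromBool≤1 (P (d + v))) (count-+ P v d)

count-mono : ∀ P {v w} → v ≤ w → count P v ≤ count P w
count-mono P {w = zero}  z≤n = z≤n
count-mono P {w = suc w} v≤1+w with m≤n⇒m<n∨m≡n v≤1+w
... | inj₂ refl        = ≤-refl
... | inj₁ (s≤s v≤w) = ≤-trans (count-mono P v≤w) (m≤n+m _ _)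

count-suc-marked : ∀ P {v} → P v ≡ true → count P (suc v) ≡ suc (count P v)
count-suc-marked P {v} Pv = cong (λ b → fromBool b + count P v) Pv

count-shift : ∀ P v → count P (suc v) ≡ fromBool (P 0) + count (P ∘ suc) v
count-shift P zero    = refl
count-shift P (suc v) =
  trans (cong (fromBool (P (suc v)) +_) (count-shift P v))
        (x∙yz≈y∙xz (fromBool (P (suc v))) (fromBool (P 0)) (count (P ∘ suc) v))

count-∸-count≤ : ∀ P {v w} → v ≤ w → count P w ∸ count P v ≤ w ∸ v
count-∸-count≤ P {v} {w} v≤w = m≤n+o⇒m∸n≤o (count P w) (count P v) (begin
  count P w                ≡⟨ cong (count P) (m∸n+n≡m v≤w) ⟨
  count P ((w ∸ v) + v)    ≤⟨ count-+ P v (w ∸ v) ⟩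
  (w ∸ v) + count P v      ≡⟨ +-comm (w ∸ v) (count P v) ⟩
  count P v + (w ∸ v)      ∎)
  where open ≤-Reasoning

count-stable : ∀ P n → (∀ k → n ≤ k → P k ≡ false) → ∀ v → count P v ≤ count P n
count-stable P n P≥n zero    = z≤n
count-stable P n P≥n (suc v) with n ≤? v
... | yes n≤v rewrite P≥n v n≤v = count-stable P n P≥n v
... | no  n≰v = count-mono P (≰⇒> n≰v)

_∪_ _∩_ : (ℕ → Bool) → (ℕ → Bool) → ℕ → Bool
(P ∪ Q) k = P k ∨ Q k
(P ∩ Q) k = P k ∧ Q k

count-∪-∩ : ∀ P Q v → count P v + count Q v ≡ count (P ∪ Q) v + count (P ∩ Q) v
count-∪-∩ P Q zero    = refl
count-∪-∩ P Q (suc v) = begin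
  (fromBool (P v) + count P v) + (fromBool (Q v) + count Q v)
    ≡⟨ interchange (fromBool (P v)) (count P v) (fromBool (Q v)) (count Q v) ⟩
  (fromBool (P v) + fromBool (Q v)) + (count P v + count Q v)
    ≡⟨ cong₂ _+_ (fromBool-∨-∧ (P v) (Q v)) (count-∪-∩ P Q v) ⟩
  (fromBool ((P ∪ Q) v) + fromBool ((P ∩ Q) v)) + (count (P ∪ Q) v + count (P ∩ Q) v)
    ≡⟨ interchange (fromBool ((P ∪ Q) v)) (fromBool ((P ∩ Q) v)) _ _ ⟩
  (fromBool ((P ∪ Q) v) + count (P ∪ Q) v) + (fromBool ((P ∩ Q) v) + count (P ∩ Q) v)
    ∎
  where open ≡-Reasoning

count-saturated : ∀ P v → (∀ k → 0 < k → k < v → P k ≡ true) → v ≤ suc (count P v)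
count-saturated P zero          _   = z≤n
count-saturated P (suc zero)    _   = s≤s z≤n
count-saturated P (suc (suc v)) all =
  subst (λ b → suc (suc v) ≤ suc (fromBool b + count P (suc v))) (sym (all (suc v) z<s ≤-refl))
    (s≤s (count-saturated P (suc v) (λ k 0<k k<v → all k 0<k (m<n⇒m<1+n k<v))))

count-cover : ∀ P Q v → (∀ k → 0 < k → k < v → (P ∪ Q) k ≡ true) →
  v ≤ suc (count P v + count Q v)
count-cover P Q v cover = begin
  v                                             ≤⟨ count-saturated (P ∪ Q) v cover ⟩
  suc (count (P ∪ Q) v)                         ≤⟨ s≤s (m≤m+n _ _) ⟩
  suc (count (P ∪ Q) v + count (P ∩ Q) v)       ≡⟨ cong suc (count-∪-∩ P Q v) ⟨
  suc (count P v + count Q v)                   ∎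
  where open ≤-Reasoning

count-disjoint : ∀ P Q → (∀ k → (P ∩ Q) k ≡ false) → (P ∪ Q) 0 ≡ false →
  ∀ v → count P (suc v) + count Q (suc v) ≤ v
count-disjoint P Q disjoint P∪Q₀ v = begin
  count P (suc v) + count Q (suc v)               ≡⟨ count-∪-∩ P Q (suc v) ⟩
  count (P ∪ Q) (suc v) + count (P ∩ Q) (suc v)   ≡⟨ cong (count (P ∪ Q) (suc v) +_)
                                                          (count-false (P ∩ Q) disjoint (suc v)) ⟩
  count (P ∪ Q) (suc v) + 0                       ≡⟨ +-identityʳ _ ⟩
  count (P ∪ Q) (suc v)                           ≡⟨ count-shift (P ∪ Q) v ⟩
  fromBool ((P ∪ Q) 0) + count ((P ∪ Q) ∘ suc) v  ≡⟨ cong (λ b → fromBool b + count ((P ∪ Q) ∘ suc) v) P∪Q₀ ⟩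
  count ((P ∪ Q) ∘ suc) v                         ≤⟨ count≤ _ v ⟩
  v                                               ∎
  where open ≤-Reasoning

rank : (ℕ → Bool) → ℕ → ℕ
rank N v = v ∸ count N v

Unmarked : (ℕ → Bool) → ℕ → Set
Unmarked N v = N v ≡ false

rank-suc-marked : ∀ N v → N v ≡ true → rank N (suc v) ≡ rank N v
rank-suc-marked N v Nv rewrite Nv = refl

rank-suc-unmarked : ∀ N v → Unmarked N v → rank N (suc v) ≡ suc (rank N v)
rank-suc-unmarked N v Nv rewrite Nv = +-∸-assoc 1 (count≤ N v)

rank≤rank-suc : ∀ N v → rank N v ≤ rank N (suc v)
rank≤rank-suc N v with N v in Nv
... | true  = ≤-refl
... | false = ≤-trans (n≤1+n _) (≤-reflexive (sym (+-∸-assoc 1 (count≤ N v))))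

rank-mono : ∀ N {v w} → v ≤ w → rank N v ≤ rank N w
rank-mono N {w = zero}  z≤n = z≤n
rank-mono N {w = suc w} v≤1+w with m≤n⇒m<n∨m≡n v≤1+w
... | inj₂ refl        = ≤-refl
... | inj₁ (s≤s v≤w) = ≤-trans (rank-mono N v≤w) (rank≤rank-suc N w)

rank-< : ∀ N {v w} → Unmarked N v → v < w → rank N v < rank N w
rank-< N {v} Nv v<w = ≤-trans (≤-reflexive (sym (rank-suc-unmarked N v Nv))) (rank-mono N v<w)

rank≤ : ∀ N v → rank N v ≤ v
rank≤ N v = m∸n≤m v (count N v)

StrictlyMonotoneOn : (ℕ → Set) → (ℕ → ℕ) → Set
StrictlyMonotoneOn G h = ∀ x y → G x → G y → x < y → h x < h y

module StrictlyMonotoneOn {G : ℕ → Set} {h : ℕ → ℕ} (mono : StrictlyMonotoneOn G h) where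

  cancel-< : ∀ x y → G x → G y → h x < h y → x < y
  cancel-< x y Gx Gy hx<hy with <-cmp x y
  ... | tri< x<y _ _ = x<y
  ... | tri≈ _ refl _ = contradiction hx<hy (<-irrefl refl)
  ... | tri> _ _ y<x = contradiction hx<hy (<-asym (mono y x Gy Gx y<x))

  injective : ∀ x y → G x → G y → h x ≡ h y → x ≡ y
  injective x y Gx Gy hx≡hy with <-cmp x y
  ... | tri< x<y _ _ = contradiction hx≡hy (<⇒≢ (mono x y Gx Gy x<y))
  ... | tri≈ _ x≡y _ = x≡y
  ... | tri> _ _ y<x = contradiction hx≡hy (≢-sym (<⇒≢ (mono y x Gy Gx y<x)))

  <ᵇ-preserved : ∀ x y → G x → G y → (h x <ᵇ h y) ≡ (x <ᵇ y)
  <ᵇ-preserved x y Gx Gy with <-cmp x y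
  ... | tri< x<y _ _ = trans (<⇒<ᵇ≡true (mono x y Gx Gy x<y)) (sym (<⇒<ᵇ≡true x<y))
  ... | tri≈ _ refl _ = trans (≥⇒<ᵇ≡false {h x} ≤-refl) (sym (≥⇒<ᵇ≡false {x} ≤-refl))
  ... | tri> _ _ y<x =
    trans (≥⇒<ᵇ≡false (<⇒≤ (mono y x Gy Gx y<x))) (sym (≥⇒<ᵇ≡false (<⇒≤ y<x)))

rank-strictlyMonotone : ∀ N → StrictlyMonotoneOn (Unmarked N) (rank N)
rank-strictlyMonotone N _ _ Nx _ = rank-< N Nx

⟨⟩-map : ∀ (h : ℕ → ℕ) → h 0 ≡ 0 → ∀ s j → map h s ⟨ j ⟩ ≡ h (s ⟨ j ⟩)
⟨⟩-map h h0≡0 []       j             = sym h0≡0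
⟨⟩-map h h0≡0 (x ∷ xs) zero          = sym h0≡0
⟨⟩-map h h0≡0 (x ∷ xs) (suc zero)    = refl
⟨⟩-map h h0≡0 (x ∷ xs) (suc (suc j)) = ⟨⟩-map h h0≡0 xs (suc j)

⟨0⟩≡0 : ∀ s → s ⟨ 0 ⟩ ≡ 0
⟨0⟩≡0 []      = refl
⟨0⟩≡0 (_ ∷ _) = refl

⟨⟩-beyond : ∀ s {j} → length s < j → s ⟨ j ⟩ ≡ 0
⟨⟩-beyond []       _                     = refl
⟨⟩-beyond (x ∷ xs) {suc (suc j)} (s≤s lt) = ⟨⟩-beyond xs lt

All-entries : ∀ {G : ℕ → Set} s → (∀ j → G (s ⟨ j ⟩)) → All G s
All-entries []       _ = []
All-entries {G} (x ∷ xs) G-entries = G-entries 1 ∷ All-entries xs G-tail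
  where
  G-tail : ∀ j → G (xs ⟨ j ⟩)
  G-tail zero    = subst G (sym (⟨0⟩≡0 xs)) (G-entries 0)
  G-tail (suc j) = G-entries (suc (suc j))

map-injectiveOn : ∀ {G : ℕ → Set} {h : ℕ → ℕ} → (∀ x y → G x → G y → h x ≡ h y → x ≡ y) →
  ∀ {s t} → All G s → All G t → map h s ≡ map h t → s ≡ t
map-injectiveOn inj []         []         _  = refl
map-injectiveOn inj (Gx ∷ Gxs) (Gy ∷ Gys) eq with ∷-injective eq
... | hx≡hy , tails≡ = cong₂ _∷_ (inj _ _ Gx Gy hx≡hy) (map-injectiveOn inj Gxs Gys tails≡)

ascᵇ : List ℕ → ℕ → Bool
ascᵇ s k = (0 <ᵇ k) ∧ (s ⟨ k ⟩ <ᵇ s ⟨ suc k ⟩)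

ascᵇ-short : ∀ s → length s ≤ 1 → ∀ k → ascᵇ s k ≡ false
ascᵇ-short s n≤1 zero    = refl
ascᵇ-short s n≤1 (suc k) rewrite ⟨⟩-beyond s {suc (suc k)} (s≤s (≤-trans n≤1 (s≤s z≤n))) = refl

asc-take : ∀ s m → asc (take m s) ≡ count (ascᵇ s) m
asc-take []          zero          = refl
asc-take []          (suc m)       = sym (count-false _ (ascᵇ-short [] z≤n) (suc m))
asc-take (x ∷ [])    zero          = refl
asc-take (x ∷ [])    (suc zero)    = refl
asc-take (x ∷ [])    (suc (suc m)) = sym (count-false _ (ascᵇ-short (x ∷ []) ≤-refl) (suc (suc m)))
asc-take (x ∷ y ∷ r) zero          = refl
asc-take (x ∷ y ∷ r) (suc zero)    = refl
asc-take (x ∷ y ∷ r) (suc (suc m)) = begin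
  fromBool (x <ᵇ y) + asc (take (suc m) (y ∷ r))    ≡⟨ cong (fromBool (x <ᵇ y) +_) (asc-take (y ∷ r) (suc m)) ⟩
  fromBool (x <ᵇ y) + count (ascᵇ (y ∷ r)) (suc m)  ≡⟨ cong (fromBool (x <ᵇ y) +_) (count-shift _ m) ⟩
  fromBool (x <ᵇ y) + count (ascᵇ (y ∷ r) ∘ suc) m  ≡⟨ count-shift (ascᵇ (x ∷ y ∷ r) ∘ suc) m ⟨
  count (ascᵇ (x ∷ y ∷ r) ∘ suc) (suc m)            ≡⟨ count-shift (ascᵇ (x ∷ y ∷ r)) (suc m) ⟨
  count (ascᵇ (x ∷ y ∷ r)) (suc (suc m))            ∎
  where open ≡-Reasoning

asc-map : ∀ {G : ℕ → Set} {h : ℕ → ℕ} → (∀ x y → G x → G y → (h x <ᵇ h y) ≡ (x <ᵇ y)) →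
  ∀ {s} → All G s → asc (map h s) ≡ asc s
asc-map h-<ᵇ []               = refl
asc-map h-<ᵇ (_ ∷ [])         = refl
asc-map h-<ᵇ (Gx ∷ Gy ∷ Grest) =
  cong₂ _+_ (cong fromBool (h-<ᵇ _ _ Gx Gy)) (asc-map h-<ᵇ (Gy ∷ Grest))

nascᵇ-sound : ∀ s i → nascᵇ s i ≡ true → 1 ≤ i × i < length s × s ⟨ suc i ⟩ ≤ s ⟨ i ⟩
nascᵇ-sound s i isNasc with 0 <ᵇ i in 0<i | i <ᵇ length s in i<n | s ⟨ i ⟩ <ᵇ s ⟨ suc i ⟩ in asc
nascᵇ-sound s i refl | true | true | false = <ᵇ≡true⇒< 0<i , <ᵇ≡true⇒< i<n , <ᵇ≡false⇒≥ asc

nascᵇ-complete : ∀ s {i} → 1 ≤ i → i < length s → s ⟨ suc i ⟩ ≤ s ⟨ i ⟩ → nascᵇ s i ≡ true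
nascᵇ-complete s 1≤i i<n s≥ rewrite <⇒<ᵇ≡true 1≤i | <⇒<ᵇ≡true i<n | ≥⇒<ᵇ≡false s≥ = refl

nascᵇ-beyond : ∀ s {k} → length s ≤ k → Unmarked (nascᵇ s) k
nascᵇ-beyond s {k} n≤k rewrite ≥⇒<ᵇ≡false n≤k = ∧-zeroʳ (0 <ᵇ k)

nascᵇ-map : ∀ (h : ℕ → ℕ) → h 0 ≡ 0 → ∀ s →
  (∀ j → (h (s ⟨ j ⟩) <ᵇ h (s ⟨ suc j ⟩)) ≡ (s ⟨ j ⟩ <ᵇ s ⟨ suc j ⟩)) →
  ∀ k → nascᵇ (map h s) k ≡ nascᵇ s k
nascᵇ-map h h0≡0 s h-<ᵇ k
  rewrite length-map h s | ⟨⟩-map h h0≡0 s k | ⟨⟩-map h h0≡0 s (suc k) | h-<ᵇ k = refl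

nascᵇ-∨-ascᵇ : ∀ s {k} → 0 < k → k < length s → (nascᵇ s k ∨ ascᵇ s k) ≡ true
nascᵇ-∨-ascᵇ s {k} 0<k k<n rewrite <⇒<ᵇ≡true 0<k | <⇒<ᵇ≡true k<n with s ⟨ k ⟩ <ᵇ s ⟨ suc k ⟩
... | true  = refl
... | false = refl

nascᵇ-∧-ascᵇ : ∀ s k → (nascᵇ s k ∧ ascᵇ s k) ≡ false
nascᵇ-∧-ascᵇ s k with 0 <ᵇ k | k <ᵇ length s | s ⟨ k ⟩ <ᵇ s ⟨ suc k ⟩
... | false | _     | _     = refl
... | true  | false | _     = refl
... | true  | true  | false = refl
... | true  | true  | true  = refl

rank-nascᵇ≤1+count-ascᵇ : ∀ s {v} → v ≤ length s → rank (nascᵇ s) v ≤ suc (count (ascᵇ s) v)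
rank-nascᵇ≤1+count-ascᵇ s {v} v≤n = m≤n+o⇒m∸n≤o v (count (nascᵇ s) v)
  (subst (v ≤_) (sym (+-suc _ _))
    (count-cover (nascᵇ s) (ascᵇ s) v (λ k 0<k k<v → nascᵇ-∨-ascᵇ s 0<k (<-≤-trans k<v v≤n))))

1+count-ascᵇ≤rank-nascᵇ : ∀ s j → suc (count (ascᵇ s) (suc j)) ≤ rank (nascᵇ s) (suc j)
1+count-ascᵇ≤rank-nascᵇ s j = m+n≤o⇒m≤o∸n _ (begin
  suc (#asc + #nasc)  ≡⟨ cong suc (+-comm #asc #nasc) ⟩
  suc (#nasc + #asc)  ≤⟨ s≤s (count-disjoint (nascᵇ s) (ascᵇ s) (nascᵇ-∧-ascᵇ s) refl j) ⟩
  suc j               ∎)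
  where
  open ≤-Reasoning
  #asc #nasc : ℕ
  #asc  = count (ascᵇ s) (suc j)
  #nasc = count (nascᵇ s) (suc j)

BelowPositions : ℕ → List ℕ → Set
BelowPositions p []       = ⊤
BelowPositions p (x ∷ xs) = x < p × BelowPositions (suc p) xs

IsInversionSeq⇒BelowPositions : ∀ s → IsInversionSeq s → BelowPositions 1 s
IsInversionSeq⇒BelowPositions s inv =
  shifted 0 s (λ i 1≤i i≤n → subst (s ⟨ i ⟩ <_) (sym (+-identityʳ i)) (inv i 1≤i i≤n))
  where
  shifted : ∀ p s → (∀ i → 1 ≤ i → i ≤ length s → s ⟨ i ⟩ < i + p) → BelowPositions (suc p) s
  shifted p []       _     = tt
  shifted p (x ∷ xs) below = below 1 (s≤s z≤n) (s≤s z≤n) , shifted (suc p) xs below-tail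
    where
    below-tail : ∀ i → 1 ≤ i → i ≤ length xs → xs ⟨ i ⟩ < i + suc p
    below-tail (suc i) _ i≤n =
      subst (xs ⟨ suc i ⟩ <_) (sym (+-suc (suc i) p)) (below (suc (suc i)) (s≤s z≤n) (s≤s i≤n))

-- The value v after γ has processed the marks ≥ m: count N v ∸ count N m marks lie in [m, v).
rankFrom : (ℕ → Bool) → ℕ → ℕ → ℕ
rankFrom N m v = v ∸ (count N v ∸ count N m)

rankFrom-below : ∀ N {m v} → v ≤ m → rankFrom N m v ≡ v
rankFrom-below N {m} {v} v≤m = cong (v ∸_) (m≤n⇒m∸n≡0 (count-mono N v≤m))

rankFrom≥ : ∀ N {m v} → m ≤ v → m ≤ rankFrom N m v
rankFrom≥ N {m} {v} m≤v = begin
  m                                   ≡⟨ m∸[m∸n]≡n m≤v ⟨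
  v ∸ (v ∸ m)                         ≤⟨ ∸-monoʳ-≤ v (count-∸-count≤ N m≤v) ⟩
  v ∸ (count N v ∸ count N m)         ∎
  where open ≤-Reasoning

rankFrom-marked : ∀ N {m v} → N m ≡ true → m < v → rankFrom N m v ≡ rankFrom N (suc m) v ∸ 1
rankFrom-marked N {m} {v} Nm m<v = begin
  v ∸ (count N v ∸ count N m)          ≡⟨ cong (v ∸_) (n<m⇒m∸n≡1+m∸[1+n] cm<cv) ⟩
  v ∸ suc d                            ≡⟨ cong (v ∸_) (+-comm 1 d) ⟩
  v ∸ (d + 1)                          ≡⟨ ∸-+-assoc v d 1 ⟨
  v ∸ d ∸ 1                            ≡⟨ cong (λ c → v ∸ (count N v ∸ c) ∸ 1) (count-suc-marked N Nm) ⟨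
  rankFrom N (suc m) v ∸ 1             ∎
  where
  open ≡-Reasoning
  d : ℕ
  d = count N v ∸ suc (count N m)
  cm<cv : count N m < count N v
  cm<cv = subst (_≤ count N v) (count-suc-marked N Nm) (count-mono N m<v)

rankFrom-suc-unmarked : ∀ N {m} → Unmarked N m → ∀ v → rankFrom N (suc m) v ≡ rankFrom N m v
rankFrom-suc-unmarked N {m} Nm v = cong (λ b → v ∸ (count N v ∸ (fromBool b + count N m))) Nm

decAfter-rankFrom : ∀ N {m} → N m ≡ true → ∀ p s → BelowPositions p s →
  decAfterFrom m p (map (rankFrom N (suc m)) s) ≡ map (rankFrom N m) s
decAfter-rankFrom N     Nm p []       _            = refl
decAfter-rankFrom N {m} Nm p (x ∷ xs) (x<p , below) =
  cong₂ _∷_ (entry x<p) (decAfter-rankFrom N Nm (suc p) xs below)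
  where
  entry : ∀ {p x} → x < p → (if (m <ᵇ p) ∧ (m <ᵇ rankFrom N (suc m) x)
    then rankFrom N (suc m) x ∸ 1 else rankFrom N (suc m) x) ≡ rankFrom N m x
  entry {p} {x} x<p with m <? x
  ... | yes m<x rewrite <⇒<ᵇ≡true (<-trans m<x x<p) | <⇒<ᵇ≡true (rankFrom≥ N m<x) =
    sym (rankFrom-marked N Nm m<x)
  ... | no m≮x rewrite rankFrom-below N (m≤n⇒m≤1+n (≮⇒≥ m≮x)) | rankFrom-below N (≮⇒≥ m≮x)
                     | ≥⇒<ᵇ≡false (≮⇒≥ m≮x) | ∧-zeroʳ (m <ᵇ p) = refl

γ-step : List ℕ → ℕ → List ℕ
γ-step t i = decAfter i t

γ-fold : ∀ N s m → BelowPositions 1 s →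
  foldl γ-step (map (rankFrom N m) s) (filterᵇ N (downFrom m)) ≡ map (rank N) s
γ-fold N s zero    _     = refl
γ-fold N s (suc m) below = by-mark (N m) refl
  where
  later : List ℕ
  later = filterᵇ N (downFrom m)
  by-mark : ∀ b → N m ≡ b →
    foldl γ-step (map (rankFrom N (suc m)) s) (filterᵇ N (m ∷ downFrom m)) ≡ map (rank N) s
  by-mark true  Nm = begin
    foldl γ-step (map (rankFrom N (suc m)) s) (filterᵇ N (m ∷ downFrom m))
      ≡⟨ cong (foldl γ-step _) (filter-accept (T? ∘ N) (Equivalence.from T-≡ Nm)) ⟩
    foldl γ-step (decAfter m (map (rankFrom N (suc m)) s)) later
      ≡⟨ cong (λ t → foldl γ-step t later) (decAfter-rankFrom N Nm 1 s below) ⟩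
    foldl γ-step (map (rankFrom N m) s) later
      ≡⟨ γ-fold N s m below ⟩
    map (rank N) s ∎
    where open ≡-Reasoning
  by-mark false Nm = begin
    foldl γ-step (map (rankFrom N (suc m)) s) (filterᵇ N (m ∷ downFrom m))
      ≡⟨ cong (foldl γ-step _) (filter-reject (T? ∘ N) (subst T Nm)) ⟩
    foldl γ-step (map (rankFrom N (suc m)) s) later
      ≡⟨ cong (λ t → foldl γ-step t later) (map-cong (rankFrom-suc-unmarked N Nm) s) ⟩
    foldl γ-step (map (rankFrom N m) s) later
      ≡⟨ γ-fold N s m below ⟩
    map (rank N) s ∎
    where open ≡-Reasoning

γ≡map-rank : ∀ c → IsInversionSeq c → γ c ≡ map (rank (nascᵇ c)) c
γ≡map-rank c inv = begin
  foldl γ-step c (nascDesc c)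
    ≡⟨ cong (λ t → foldl γ-step t (nascDesc c)) start ⟨
  foldl γ-step (map (rankFrom N (length c)) c) (nascDesc c)
    ≡⟨ γ-fold N c (length c) (IsInversionSeq⇒BelowPositions c inv) ⟩
  map (rank N) c
    ∎
  where
  open ≡-Reasoning
  N : ℕ → Bool
  N = nascᵇ c
  start : map (rankFrom N (length c)) c ≡ c
  start = trans (map-cong (λ v → cong (v ∸_) (m≤n⇒m∸n≡0 (count-stable N _ (λ _ → nascᵇ-beyond c) v))) c)
                (map-id c)

nonzero-entry-position : ∀ s j → 1 ≤ s ⟨ j ⟩ → 1 ≤ j × j ≤ length s
nonzero-entry-position s zero    1≤s₀ = contradiction (⟨0⟩≡0 s) (≢-sym (<⇒≢ 1≤s₀))
nonzero-entry-position s (suc j) 1≤sⱼ with suc j ≤? length s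
... | yes j≤n = s≤s z≤n , j≤n
... | no  j≰n = contradiction (⟨⟩-beyond s (≰⇒> j≰n)) (≢-sym (<⇒≢ 1≤sⱼ))

InC⇒entries-unmarked : ∀ {n} c → InC n c → ∀ j → Unmarked (nascᵇ c) (c ⟨ j ⟩)
InC⇒entries-unmarked c (_ , inv , nasc-value-absent) j with nascᵇ c (c ⟨ j ⟩) in isNasc
... | false = refl
... | true with nascᵇ-sound c (c ⟨ j ⟩) isNasc
...   | 1≤v , v<n , desc with nonzero-entry-position c j 1≤v
...     | 1≤j , j≤n =
  contradiction refl (nasc-value-absent (c ⟨ j ⟩) 1≤v v<n desc j (inv j 1≤j j≤n) j≤n)

module PreservesStatistics {G : ℕ → Set} {h : ℕ → ℕ} (h0≡0 : h 0 ≡ 0) (G0 : G 0)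
  (mono : StrictlyMonotoneOn G h) (s : List ℕ) (G-entries : ∀ j → G (s ⟨ j ⟩)) where

  open StrictlyMonotoneOn mono

  private
    t : List ℕ
    t = map h s

    t⟨⟩ : ∀ j → t ⟨ j ⟩ ≡ h (s ⟨ j ⟩)
    t⟨⟩ = ⟨⟩-map h h0≡0 s

    ≤-length : ∀ {i} → i ≤ length s → i ≤ length t
    ≤-length = subst (_ ≤_) (sym (length-map h s))

    ≤-length⁻ : ∀ {i} → i ≤ length t → i ≤ length s
    ≤-length⁻ = subst (_ ≤_) (length-map h s)

    <-entries : ∀ j k → s ⟨ j ⟩ < s ⟨ k ⟩ → t ⟨ j ⟩ < t ⟨ k ⟩
    <-entries j k lt rewrite t⟨⟩ j | t⟨⟩ k = mono _ _ (G-entries j) (G-entries k) lt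

    <-entries⁻ : ∀ j k → t ⟨ j ⟩ < t ⟨ k ⟩ → s ⟨ j ⟩ < s ⟨ k ⟩
    <-entries⁻ j k lt rewrite t⟨⟩ j | t⟨⟩ k = cancel-< _ _ (G-entries j) (G-entries k) lt

    ≡-entries : ∀ j k → s ⟨ j ⟩ ≡ s ⟨ k ⟩ → t ⟨ j ⟩ ≡ t ⟨ k ⟩
    ≡-entries j k eq rewrite t⟨⟩ j | t⟨⟩ k = cong h eq

    ≡-entries⁻ : ∀ j k → t ⟨ j ⟩ ≡ t ⟨ k ⟩ → s ⟨ j ⟩ ≡ s ⟨ k ⟩
    ≡-entries⁻ j k eq rewrite t⟨⟩ j | t⟨⟩ k = injective _ _ (G-entries j) (G-entries k) eq

    zero-entry : ∀ j → s ⟨ j ⟩ ≡ 0 → t ⟨ j ⟩ ≡ 0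
    zero-entry j eq rewrite t⟨⟩ j | eq = h0≡0

    zero-entry⁻ : ∀ j → t ⟨ j ⟩ ≡ 0 → s ⟨ j ⟩ ≡ 0
    zero-entry⁻ j eq rewrite t⟨⟩ j = injective _ _ (G-entries j) G0 (trans eq (sym h0≡0))

  ASC⇔ : ∀ i → ASC s i ⇔ ASC t i
  ASC⇔ i = mk⇔ (λ (1≤i , i<n , asc) → 1≤i , ≤-length i<n , <-entries i (suc i) asc)
               (λ (1≤i , i<n , asc) → 1≤i , ≤-length⁻ i<n , <-entries⁻ i (suc i) asc)

  DIST⇔ : ∀ i → DIST s i ⇔ DIST t i
  DIST⇔ i = mk⇔
    (λ (2≤i , i≤n , nonzero , last) → 2≤i , ≤-length i≤n , nonzero ∘ zero-entry⁻ i ,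
      λ j i<j j≤n → last j i<j (≤-length⁻ j≤n) ∘ ≡-entries⁻ i j)
    (λ (2≤i , i≤n , nonzero , last) → 2≤i , ≤-length⁻ i≤n , nonzero ∘ zero-entry i ,
      λ j i<j j≤n → last j i<j (≤-length j≤n) ∘ ≡-entries i j)

  ZERO⇔ : ∀ i → ZERO s i ⇔ ZERO t i
  ZERO⇔ i = mk⇔ (λ (1≤i , i≤n , sᵢ≡0) → 1≤i , ≤-length i≤n , zero-entry i sᵢ≡0)
                (λ (1≤i , i≤n , tᵢ≡0) → 1≤i , ≤-length⁻ i≤n , zero-entry⁻ i tᵢ≡0)

  RMIN⇔ : ∀ i → RMIN s i ⇔ RMIN t i
  RMIN⇔ i = mk⇔
    (λ (1≤i , i≤n , min) → 1≤i , ≤-length i≤n , λ j i<j j≤n → <-entries i j (min j i<j (≤-length⁻ j≤n)))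
    (λ (1≤i , i≤n , min) → 1≤i , ≤-length⁻ i≤n , λ j i<j j≤n → <-entries⁻ i j (min j i<j (≤-length j≤n)))

nascᵇ-γ : ∀ {n} c → InC n c → ∀ k → nascᵇ (γ c) k ≡ nascᵇ c k
nascᵇ-γ c C@(_ , inv , _) k rewrite γ≡map-rank c inv =
  nascᵇ-map (rank (nascᵇ c)) refl c
    (λ j → <ᵇ-preserved (c ⟨ j ⟩) (c ⟨ suc j ⟩) (unmarked j) (unmarked (suc j))) k
  where
  open StrictlyMonotoneOn (rank-strictlyMonotone (nascᵇ c))
  unmarked : ∀ j → Unmarked (nascᵇ c) (c ⟨ j ⟩)
  unmarked = InC⇒entries-unmarked c C

γ-ascent : ∀ {n} c → InC n c → InA n (γ c)
γ-ascent c C@(length≡n , inv , _) rewrite γ≡map-rank c inv =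
  trans (length-map (rank N) c) length≡n , inversion , ascent
  where
  N : ℕ → Bool
  N = nascᵇ c
  open StrictlyMonotoneOn (rank-strictlyMonotone N)
  r⟨⟩ : ∀ i → map (rank N) c ⟨ i ⟩ ≡ rank N (c ⟨ i ⟩)
  r⟨⟩ = ⟨⟩-map (rank N) refl c
  ≤-length⁻ : ∀ {i} → i ≤ length (map (rank N) c) → i ≤ length c
  ≤-length⁻ = subst (_ ≤_) (length-map (rank N) c)

  inversion : IsInversionSeq (map (rank N) c)
  inversion i 1≤i i≤n rewrite r⟨⟩ i = ≤-<-trans (rank≤ N (c ⟨ i ⟩)) (inv i 1≤i (≤-length⁻ i≤n))

  ascent : ∀ i → 2 ≤ i → i ≤ length (map (rank N) c) →
    map (rank N) c ⟨ i ⟩ ≤ asc (take (i ∸ 1) (map (rank N) c)) + 1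
  ascent i 2≤i i≤n = begin
    map (rank N) c ⟨ i ⟩                      ≡⟨ r⟨⟩ i ⟩
    rank N (c ⟨ i ⟩)                          ≤⟨ rank-nascᵇ≤1+count-ascᵇ c cᵢ≤n ⟩
    suc (count (ascᵇ c) (c ⟨ i ⟩))            ≤⟨ s≤s (count-mono (ascᵇ c) cᵢ≤i-1) ⟩
    suc (count (ascᵇ c) (i ∸ 1))              ≡⟨ +-comm 1 _ ⟩
    count (ascᵇ c) (i ∸ 1) + 1                ≡⟨ cong (_+ 1) (asc-take c (i ∸ 1)) ⟨
    asc (take (i ∸ 1) c) + 1                  ≡⟨ cong (_+ 1) (asc-map <ᵇ-preserved prefix-unmarked) ⟨
    asc (map (rank N) (take (i ∸ 1) c)) + 1   ≡⟨ cong (λ s → asc s + 1) (take-map (i ∸ 1) c) ⟨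
    asc (take (i ∸ 1) (map (rank N) c)) + 1   ∎
    where
    open ≤-Reasoning
    cᵢ<i : c ⟨ i ⟩ < i
    cᵢ<i = inv i (≤-trans (s≤s z≤n) 2≤i) (≤-length⁻ i≤n)
    cᵢ≤i-1 : c ⟨ i ⟩ ≤ i ∸ 1
    cᵢ≤i-1 = m+n≤o⇒m≤o∸n (c ⟨ i ⟩) (subst (_≤ i) (+-comm 1 (c ⟨ i ⟩)) cᵢ<i)
    cᵢ≤n : c ⟨ i ⟩ ≤ length c
    cᵢ≤n = <⇒≤ (<-≤-trans cᵢ<i (≤-length⁻ i≤n))
    prefix-unmarked : All (Unmarked N) (take (i ∸ 1) c)
    prefix-unmarked = take⁺ (i ∸ 1) (All-entries c (InC⇒entries-unmarked c C))

γ-injective : ∀ {n} c c′ → InC n c → InC n c′ → γ c ≡ γ c′ → c ≡ c′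
γ-injective c c′ C@(_ , inv , _) C′@(_ , inv′ , _) γc≡γc′ =
  map-injectiveOn injective (All-entries c (InC⇒entries-unmarked c C)) (All-entries c′ unmarked′) ranks≡
  where
  N : ℕ → Bool
  N = nascᵇ c
  open StrictlyMonotoneOn (rank-strictlyMonotone N)
  N≗N′ : ∀ k → N k ≡ nascᵇ c′ k
  N≗N′ k = trans (sym (nascᵇ-γ c C k)) (trans (cong (λ s → nascᵇ s k) γc≡γc′) (nascᵇ-γ c′ C′ k))
  unmarked′ : ∀ j → Unmarked N (c′ ⟨ j ⟩)
  unmarked′ j = trans (N≗N′ (c′ ⟨ j ⟩)) (InC⇒entries-unmarked c′ C′ j)
  ranks≡ : map (rank N) c ≡ map (rank N) c′
  ranks≡ = begin
    map (rank N) c              ≡⟨ γ≡map-rank c inv ⟨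
    γ c                         ≡⟨ γc≡γc′ ⟩
    γ c′                        ≡⟨ γ≡map-rank c′ inv′ ⟩
    map (rank (nascᵇ c′)) c′    ≡⟨ map-cong (λ v → cong (v ∸_) (count-cong N≗N′ v)) c′ ⟨
    map (rank N) c′             ∎
    where open ≡-Reasoning

γ-statistics : ∀ {n} c → InC n c → (i : ℕ) →
  (ASC c i ⇔ ASC (γ c) i) × (DIST c i ⇔ DIST (γ c) i) ×
  (ZERO c i ⇔ ZERO (γ c) i) × (RMIN c i ⇔ RMIN (γ c) i)
γ-statistics c C@(_ , inv , _) i rewrite γ≡map-rank c inv =
  ASC⇔ i , DIST⇔ i , ZERO⇔ i , RMIN⇔ i
  where
  open PreservesStatistics refl refl (rank-strictlyMonotone (nascᵇ c)) c (InC⇒entries-unmarked c C)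

-- The least unmarked y ≥ x, provided there is one below x + fuel.
nextUnmarked : (ℕ → Bool) → ℕ → ℕ → ℕ
nextUnmarked N zero       x = x
nextUnmarked N (suc fuel) x = if N x then nextUnmarked N fuel (suc x) else x

nextUnmarked-unmarked : ∀ N {m} → (∀ y → m ≤ y → Unmarked N y) →
  ∀ fuel x → m ≤ x + fuel → Unmarked N (nextUnmarked N fuel x)
nextUnmarked-unmarked N {m} N≥m zero       x m≤x = N≥m x (subst (m ≤_) (+-identityʳ x) m≤x)
nextUnmarked-unmarked N {m} N≥m (suc fuel) x m≤x+1+fuel with N x in Nx
... | true  = nextUnmarked-unmarked N N≥m fuel (suc x) (subst (m ≤_) (+-suc x fuel) m≤x+1+fuel)
... | false = Nx

rank-nextUnmarked : ∀ N fuel x → rank N (nextUnmarked N fuel x) ≡ rank N x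
rank-nextUnmarked N zero       x = refl
rank-nextUnmarked N (suc fuel) x with N x in Nx
... | true  = trans (rank-nextUnmarked N fuel (suc x)) (rank-suc-marked N x Nx)
... | false = refl

unrank : (ℕ → Bool) → ℕ → ℕ → ℕ
unrank N m zero    = 0
unrank N m (suc k) = nextUnmarked N m (suc (unrank N m k))

module Unrank (N : ℕ → Bool) (m : ℕ) (N0 : Unmarked N 0) (N≥m : ∀ y → m ≤ y → Unmarked N y) where

  unrank-unmarked : ∀ k → Unmarked N (unrank N m k)
  unrank-unmarked zero    = N0
  unrank-unmarked (suc k) = nextUnmarked-unmarked N N≥m m (suc (unrank N m k)) (m≤n+m m _)

  rank-unrank : ∀ k → rank N (unrank N m k) ≡ k
  rank-unrank zero    = refl
  rank-unrank (suc k) = begin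
    rank N (nextUnmarked N m (suc (unrank N m k)))   ≡⟨ rank-nextUnmarked N m _ ⟩
    rank N (suc (unrank N m k))                      ≡⟨ rank-suc-unmarked N _ (unrank-unmarked k) ⟩
    suc (rank N (unrank N m k))                      ≡⟨ cong suc (rank-unrank k) ⟩
    suc k                                            ∎
    where open ≡-Reasoning

  unrank-least : ∀ {k w} → Unmarked N w → k ≤ rank N w → unrank N m k ≤ w
  unrank-least {k} {w} Nw k≤rank = ≮⇒≥ λ w<unrank →
    <⇒≱ (subst (rank N w <_) (rank-unrank k) (rank-< N Nw w<unrank)) k≤rank

  unrank-strictlyMonotone : StrictlyMonotoneOn (λ _ → ⊤) (unrank N m)
  unrank-strictlyMonotone x y _ _ x<y = cancel-< _ _ (unrank-unmarked x) (unrank-unmarked y)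
    (subst₂ _<_ (sym (rank-unrank x)) (sym (rank-unrank y)) x<y)
    where open StrictlyMonotoneOn (rank-strictlyMonotone N)

γ-surjective : ∀ {n} a → InA n a → Σ[ c ∈ List ℕ ] (InC n c × γ c ≡ a)
γ-surjective a (length≡n , inv , ascent) =
  c , (trans (length-map g a) length≡n , c-inversion , c-nasc-values-absent) , γc≡a
  where
  N : ℕ → Bool
  N = nascᵇ a
  open Unrank N (length a) refl (λ y → nascᵇ-beyond a)
  open StrictlyMonotoneOn unrank-strictlyMonotone using (<ᵇ-preserved)
  g : ℕ → ℕ
  g = unrank N (length a)
  c : List ℕ
  c = map g a
  c⟨⟩ : ∀ j → c ⟨ j ⟩ ≡ g (a ⟨ j ⟩)
  c⟨⟩ = ⟨⟩-map g refl a
  nascᵇ-c : ∀ k → nascᵇ c k ≡ N k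
  nascᵇ-c = nascᵇ-map g refl a (λ j → <ᵇ-preserved (a ⟨ j ⟩) (a ⟨ suc j ⟩) tt tt)

  g-entry< : ∀ j → 1 ≤ j → j ≤ length a → g (a ⟨ j ⟩) < j
  g-entry< 1             _ 1≤n = subst (λ v → g v < 1) (sym (n<1⇒n≡0 (inv 1 ≤-refl 1≤n))) z<s
  g-entry< (suc (suc j)) _ j+2≤n =
    by-mark (N (suc j)) refl (g-entry< (suc j) (s≤s z≤n) (≤-trans (n≤1+n _) j+2≤n))
    where
    by-mark : ∀ b → N (suc j) ≡ b → g (a ⟨ suc j ⟩) < suc j → g (a ⟨ suc (suc j) ⟩) < suc (suc j)
    by-mark true  Nj previous =
      s≤s (≤-trans (unrank-least (unrank-unmarked (a ⟨ suc j ⟩)) aⱼ₊₂≤rank) (<⇒≤ previous))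
      where
      aⱼ₊₂≤rank : a ⟨ suc (suc j) ⟩ ≤ rank N (g (a ⟨ suc j ⟩))
      aⱼ₊₂≤rank = subst (a ⟨ suc (suc j) ⟩ ≤_) (sym (rank-unrank (a ⟨ suc j ⟩)))
                    (proj₂ (proj₂ (nascᵇ-sound a (suc j) Nj)))
    by-mark false Nj _ = s≤s (unrank-least Nj (begin
      a ⟨ suc (suc j) ⟩               ≤⟨ ascent (suc (suc j)) (s≤s (s≤s z≤n)) j+2≤n ⟩
      asc (take (suc j) a) + 1        ≡⟨ trans (cong (_+ 1) (asc-take a (suc j))) (+-comm _ 1) ⟩
      suc (count (ascᵇ a) (suc j))    ≤⟨ 1+count-ascᵇ≤rank-nascᵇ a j ⟩
      rank N (suc j)                  ∎))
      where open ≤-Reasoning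

  c-inversion : IsInversionSeq c
  c-inversion i 1≤i i≤n rewrite c⟨⟩ i = g-entry< i 1≤i (subst (i ≤_) (length-map g a) i≤n)

  c-nasc-values-absent : ∀ i → 1 ≤ i → i < length c → c ⟨ i ⟩ ≥ c ⟨ suc i ⟩ →
    ∀ j → i < j → j ≤ length c → c ⟨ j ⟩ ≢ i
  c-nasc-values-absent i 1≤i i<n desc j _ _ cⱼ≡i =
    contradiction (trans (sym marked) unmarked) λ ()
    where
    marked : N i ≡ true
    marked = trans (sym (nascᵇ-c i)) (nascᵇ-complete c 1≤i i<n desc)
    unmarked : N i ≡ false
    unmarked = subst (Unmarked N) (trans (sym (c⟨⟩ j)) cⱼ≡i) (unrank-unmarked (a ⟨ j ⟩))

  γc≡a : γ c ≡ a
  γc≡a = begin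
    γ c                       ≡⟨ γ≡map-rank c c-inversion ⟩
    map (rank (nascᵇ c)) c    ≡⟨ map-cong (λ v → cong (v ∸_) (count-cong nascᵇ-c v)) c ⟩
    map (rank N) (map g a)    ≡⟨ map-∘ a ⟨
    map (rank N ∘ g) a        ≡⟨ map-cong rank-unrank a ⟩
    map (λ v → v) a           ≡⟨ map-id a ⟩
    a                         ∎
    where open ≡-Reasoning

proposition3p11 : (n : ℕ) → 1 ≤ n →
    ((c : List ℕ) → InC n c → InA n (γ c)) ×
    ((c c′ : List ℕ) → InC n c → InC n c′ → γ c ≡ γ c′ → c ≡ c′) ×
    ((a : List ℕ) → InA n a → Σ[ c ∈ List ℕ ] (InC n c × γ c ≡ a)) ×
    ((c : List ℕ) → InC n c → (i : ℕ) →
      (ASC c i ⇔ ASC (γ c) i) × (DIST c i ⇔ DIST (γ c) i) ×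
      (ZERO c i ⇔ ZERO (γ c) i) × (RMIN c i ⇔ RMIN (γ c) i))
proposition3p11 n _ = γ-ascent , γ-injective , γ-surjective , γ-statistics
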